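{- There is no vertex-transitive equivelar map with Schläfli type $\{3,7\}$ whose automorphism group has exactly $7$ orbits on flags.
   Context: A map is a 2-cell embedding of a finite multigraph on a closed surface without boundary; faces are the components of the complement of the graph. Flags are the triangles of the induced triangulation with vertices a vertex, the midpoint of an incident edge and the centre of a face incident to that edge. An automorphism is a graph automorphism extending to a homeomorphism of the surface; $\Gamma(M)$ is the automorphism group, acting on flags. $M$ is vertex-transitive if $\Gamma(M)$ is transitive on vertices. $M$ is equivelar with Schläfli type $\{p,q\}$ if every face has $p$ edges and every vertex has degree $q$. -}

module Defs where

open import Data.Nat using (ℕ; _*_)
open import Data.Fin using (Fin)
open import Data.List using (List; length)
open import Data.List.Membership.Propositional using (_∈_)
open import Data.List.Relation.Unary.Unique.Propositional using (Unique)
open import Data.Product using (Σ; ∃; _×_)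
open import Relation.Nullary using (¬_)
open import Relation.Binary.PropositionalEquality using (_≡_; _≢_)
open import Relation.Binary.Construct.Closure.ReflexiveTransitive using (Star)
open import Function.Bundles using (_⇔_)

-- Combinatorial (flag-graph) description of a map with n flags:
-- r₀ (change vertex), r₁ (change edge), r₂ (change face).
record PreMap (n : ℕ) : Set where
  field
    r₀ r₁ r₂ : Fin n → Fin n

data Step {n : ℕ} (gs : List (Fin n → Fin n)) : Fin n → Fin n → Set where
  step : ∀ {f x} → f ∈ gs → Step gs x (f x)

-- y lies in the orbit of x under the group generated by gs
-- (generators are involutions, so the reflexive-transitive closure suffices)
InOrbit : {n : ℕ} → List (Fin n → Fin n) → Fin n → Fin n → Set
InOrbit gs = Star (Step gs)

IsInvolutionFPF : {n : ℕ} → (Fin n → Fin n) → Set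
IsInvolutionFPF f = (∀ x → f (f x) ≡ x) × (∀ x → f x ≢ x)

module _ {n : ℕ} (M : PreMap n) where
  open PreMap M
  open import Data.List using ([]; _∷_)

  allGens : List (Fin n → Fin n)
  allGens = r₀ ∷ r₁ ∷ r₂ ∷ []

  -- <r₁,r₂>-orbits are vertices, <r₀,r₁>-orbits are faces
  vertexGens faceGens : List (Fin n → Fin n)
  vertexGens = r₁ ∷ r₂ ∷ []
  faceGens   = r₀ ∷ r₁ ∷ []

  IsMap : Set
  IsMap = IsInvolutionFPF r₀ × IsInvolutionFPF r₁ × IsInvolutionFPF r₂
        × IsInvolutionFPF (λ x → r₀ (r₂ x))
        × (∀ x y → InOrbit allGens x y)

  OrbitSize : List (Fin n → Fin n) → Fin n → ℕ → Set
  OrbitSize gs x k = Σ (List (Fin n)) λ l →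
    Unique l × length l ≡ k × (∀ y → (y ∈ l) ⇔ InOrbit gs x y)

  -- every face has p edges (2p flags), every vertex has degree q (2q flags)
  Equivelar : ℕ → ℕ → Set
  Equivelar p q = (∀ x → OrbitSize faceGens x (2 * p))
                × (∀ x → OrbitSize vertexGens x (2 * q))

  record Automorphism : Set where
    field
      φ ψ : Fin n → Fin n
      φψ : ∀ x → φ (ψ x) ≡ x
      ψφ : ∀ x → ψ (φ x) ≡ x
      c₀ : ∀ x → φ (r₀ x) ≡ r₀ (φ x)
      c₁ : ∀ x → φ (r₁ x) ≡ r₁ (φ x)
      c₂ : ∀ x → φ (r₂ x) ≡ r₂ (φ x)

  -- Γ(M) is transitive on vertices (vertex of φ x equals vertex of y)
  VertexTransitive : Set
  VertexTransitive = ∀ x y → Σ Automorphism λ a →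
    InOrbit vertexGens (Automorphism.φ a x) y

  SameFlagOrbit : Fin n → Fin n → Set
  SameFlagOrbit x y = Σ Automorphism λ a → Automorphism.φ a x ≡ y

  FlagOrbitCount : ℕ → Set
  FlagOrbitCount k = Σ (Fin k → Fin n) λ rep →
      (∀ i j → SameFlagOrbit (rep i) (rep j) → i ≡ j)
    × (∀ x → ∃ λ i → SameFlagOrbit (rep i) x)

-- Automorphisms commute with r₀, r₁, r₂, so these induce involutions R₀, R₁, R₂ on the 7 flag
-- orbits.  R₀ commutes with R₂, and since faces are triangles and vertices have degree 7 (an
-- orbit of 2p flags under two fixed-point-free involutions a, b is closed by (ba)ᵖ) also
-- (R₁R₀)³ = 1 and (R₂R₁)⁷ = 1; vertex-transitivity makes ⟨R₁, R₂⟩ transitive on the orbits.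
-- On 7 points this forces ρ = R₂R₁ to be a 7-cycle, so with f the unique fixed point of R₂ and
-- eᵢ = ρⁱ f, R₂ and R₁ act as i ↦ -i and i ↦ -1-i modulo 7.  Commuting with R₂ and the braid
-- relation R₀R₁R₀ = R₁R₀R₁ then force R₀ f = f, R₀ e₆ = e₃, R₀ e₁ = e₄, and finally
-- ρ (R₀ e₂) = R₀ e₂, which is impossible.
module Submission where

open import Defs
open import Data.Empty using (⊥; ⊥-elim)
open import Data.Fin as Fin using (Fin; zero; suc; toℕ; fromℕ<; splitAt; join)
import Data.Fin.Properties as Finₚ
open import Data.List using (List; []; _∷_; length; lookup)
open import Data.List.Membership.Propositional using (_∈_)
open import Data.List.Membership.Propositional.Properties using (∈-lookup)
import Data.List.Relation.Unary.All as All
open import Data.List.Relation.Unary.AllPairs using (_∷_)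
open import Data.List.Relation.Unary.Any using (here; there; index)
open import Data.List.Relation.Unary.Any.Properties using (lookup-index)
open import Data.List.Relation.Unary.Unique.Propositional using (Unique)
open import Data.Nat using (ℕ; zero; suc; _+_; _*_; _∸_; _≤_; _<_; s≤s; z<s)
import Data.Nat.Properties as ℕₚ
open import Data.Nat.Tactic.RingSolver using (solve-∀)
open import Data.Nat.GCD using (gcd; gcd-GCD; module Bézout)
open import Data.Product using (Σ; ∃; _×_; _,_; proj₁; proj₂)
open import Data.Sum using (_⊎_; inj₁; inj₂)
open import Function.Base using (_∘_)
open import Function.Bundles using (Equivalence; _⇔_)
open import Function.Definitions using (Injective)
import Function.Endo.Propositional as Endo
open import Relation.Binary.Definitions using (tri<; tri≈; tri>)
open import Relation.Binary.PropositionalEquality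
open import Relation.Binary.Construct.Closure.ReflexiveTransitive using (ε; _◅_; _◅◅_)
open import Relation.Nullary using (¬_; yes; no)

lookup-injective : ∀ {A : Set} {xs : List A} → Unique xs → Injective _≡_ _≡_ (lookup xs)
lookup-injective {xs = _ ∷ _} _          {zero}  {zero}  _  = refl
lookup-injective              (x∉ ∷ _)  {zero}  {suc j} eq = ⊥-elim (All.lookup x∉ (∈-lookup j) eq)
lookup-injective              (x∉ ∷ _)  {suc i} {zero}  eq =
  ⊥-elim (All.lookup x∉ (∈-lookup i) (sym eq))
lookup-injective              (_ ∷ u)   {suc i} {suc j} eq = cong suc (lookup-injective u eq)

unique⇒length≤ : ∀ {A : Set} {m} {xs : List A} → Unique xs → (g : Fin m → A) →
                 (∀ {y} → y ∈ xs → ∃ λ c → g c ≡ y) → length xs ≤ m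
unique⇒length≤ {xs = xs} xs-unique g covers = Finₚ.injective⇒≤ code-injective
  where
    code : Fin (length xs) → Fin _
    code i = proj₁ (covers (∈-lookup i))

    code-injective : Injective _≡_ _≡_ code
    code-injective {i} {j} eq = lookup-injective xs-unique (begin
      lookup xs i                 ≡⟨ sym (proj₂ (covers (∈-lookup i))) ⟩
      g (code i)                  ≡⟨ cong g eq ⟩
      g (code j)                  ≡⟨ proj₂ (covers (∈-lookup j)) ⟩
      lookup xs j                 ∎)
      where open ≡-Reasoning

injective⇒surjective : ∀ {n} {f : Fin n → Fin n} → Injective _≡_ _≡_ f → ∀ y → ∃ λ i → f i ≡ y
injective⇒surjective {n} {f} f-injective y with Finₚ.any? (λ i → f i Fin.≟ y)
... | yes hit = hit
... | no miss = ⊥-elim (ℕₚ.1+n≰n (Finₚ.injective⇒≤ extended-injective))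
  where
    extended : Fin (suc n) → Fin n
    extended zero    = y
    extended (suc i) = f i

    extended-injective : Injective _≡_ _≡_ extended
    extended-injective {zero}  {zero}  _  = refl
    extended-injective {zero}  {suc j} eq = ⊥-elim (miss (j , sym eq))
    extended-injective {suc i} {zero}  eq = ⊥-elim (miss (i , eq))
    extended-injective {suc i} {suc j} eq = cong suc (f-injective eq)

coveredByTwo⇒≤2 : ∀ {n} {u v : Fin n} → (∀ i → i ≡ u ⊎ i ≡ v) → n ≤ 2
coveredByTwo⇒≤2 covers = Finₚ.injective⇒≤ side-injective
  where
    side : Fin _ → Fin 2
    side i with covers i
    ... | inj₁ _ = zero
    ... | inj₂ _ = suc zero

    side-injective : Injective _≡_ _≡_ side
    side-injective {i} {j} eq with covers i | covers j
    ... | inj₁ i≡u | inj₁ j≡u = trans i≡u (sym j≡u)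
    ... | inj₂ i≡v | inj₂ j≡v = trans i≡v (sym j≡v)
    side-injective () | inj₁ _ | inj₂ _
    side-injective () | inj₂ _ | inj₁ _

orbit-closed : ∀ {n} {gs : List (Fin n → Fin n)} (P : Fin n → Set) →
               (∀ {f} → f ∈ gs → ∀ {y} → P y → P (f y)) →
               ∀ {x y} → InOrbit gs x y → P x → P y
orbit-closed P closed ε                  Px = Px
orbit-closed P closed (step f∈gs ◅ path) Px = orbit-closed P closed path (closed f∈gs Px)

module _ {A : Set} where
  open Endo A using (_^_) public
  open Endo A using (^-homo)

  ^-+ : ∀ (f : A → A) m n x → (f ^ (m + n)) x ≡ (f ^ m) ((f ^ n) x)
  ^-+ f m n x = cong-app (^-homo f m n) x

  ^-suc : ∀ (f : A → A) k x → (f ^ suc k) x ≡ (f ^ k) (f x)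
  ^-suc f k x = trans (cong (λ m → (f ^ m) x) (ℕₚ.+-comm 1 k)) (^-+ f k 1 x)

  ^-injective : ∀ {f : A → A} → Injective _≡_ _≡_ f → ∀ k → Injective _≡_ _≡_ (f ^ k)
  ^-injective f-injective zero    eq = eq
  ^-injective f-injective (suc k) eq = ^-injective f-injective k (f-injective eq)

  ^-*-fixed : ∀ {f : A → A} {m x} → (f ^ m) x ≡ x → ∀ q → (f ^ (q * m)) x ≡ x
  ^-*-fixed                 fixed zero    = refl
  ^-*-fixed {f} {m} {x} fixed (suc q) = begin
    (f ^ (m + q * m)) x        ≡⟨ ^-+ f m (q * m) x ⟩
    (f ^ m) ((f ^ (q * m)) x)  ≡⟨ cong (f ^ m) (^-*-fixed fixed q) ⟩
    (f ^ m) x                  ≡⟨ fixed ⟩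
    x                          ∎
    where open ≡-Reasoning

  ^-combination-fixed : ∀ {f : A → A} {k l d x} → (f ^ k) x ≡ x → (f ^ l) x ≡ x →
                        ∀ s t → d + s * k ≡ t * l → (f ^ d) x ≡ x
  ^-combination-fixed {f} {k} {l} {d} {x} fixedₖ fixedₗ s t eq = begin
    (f ^ d) x                  ≡⟨ cong (f ^ d) (sym (^-*-fixed fixedₖ s)) ⟩
    (f ^ d) ((f ^ (s * k)) x)  ≡⟨ sym (^-+ f d (s * k) x) ⟩
    (f ^ (d + s * k)) x        ≡⟨ cong (λ e → (f ^ e) x) eq ⟩
    (f ^ (t * l)) x            ≡⟨ ^-*-fixed fixedₗ t ⟩
    x                          ∎
    where open ≡-Reasoning

  ^-gcd-fixed : ∀ {f : A → A} {m n x} → (f ^ m) x ≡ x → (f ^ n) x ≡ x → (f ^ gcd m n) x ≡ x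
  ^-gcd-fixed {m = m} {n} fixedₘ fixedₙ with Bézout.identity (gcd-GCD m n)
  ... | Bézout.+- p q eq = ^-combination-fixed fixedₙ fixedₘ q p eq
  ... | Bézout.-+ p q eq = ^-combination-fixed fixedₘ fixedₙ p q eq

  ^-collision : ∀ {f : A → A} {i j x} → Injective _≡_ _≡_ f → i < j →
                (f ^ i) x ≡ (f ^ j) x → (f ^ (j ∸ i)) x ≡ x
  ^-collision {f} {i} {j} {x} f-injective i<j eq = ^-injective f-injective i (begin
    (f ^ i) ((f ^ (j ∸ i)) x)  ≡⟨ sym (^-+ f i (j ∸ i) x) ⟩
    (f ^ (i + (j ∸ i))) x      ≡⟨ cong (λ e → (f ^ e) x) (ℕₚ.m+[n∸m]≡n (ℕₚ.<⇒≤ i<j)) ⟩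
    (f ^ j) x                  ≡⟨ sym eq ⟩
    (f ^ i) x                  ∎)
    where open ≡-Reasoning

  ^-conjugate : ∀ {f r : A → A} → (∀ y → f (r (f y)) ≡ r y) → ∀ k y → (f ^ k) (r ((f ^ k) y)) ≡ r y
  ^-conjugate                 f-conj zero    y = refl
  ^-conjugate {f} {r} f-conj (suc k) y = begin
    (f ^ suc k) (r (f ((f ^ k) y)))   ≡⟨ ^-suc f k _ ⟩
    (f ^ k) (f (r (f ((f ^ k) y))))   ≡⟨ cong (f ^ k) (f-conj _) ⟩
    (f ^ k) (r ((f ^ k) y))           ≡⟨ ^-conjugate f-conj k y ⟩
    r y                               ∎
    where open ≡-Reasoning

involutive⇒injective : ∀ {A : Set} {f : A → A} → (∀ x → f (f x) ≡ x) → Injective _≡_ _≡_ f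
involutive⇒injective {f = f} f-involutive {x} {y} eq =
  trans (sym (f-involutive x)) (trans (cong f eq) (f-involutive y))

module InvolutionPair {A : Set} (a b : A → A)
  (a-involutive : ∀ x → a (a x) ≡ x) (b-involutive : ∀ x → b (b x) ≡ x) where
  open ≡-Reasoning

  ρ : A → A
  ρ = b ∘ a

  a-injective : Injective _≡_ _≡_ a
  a-injective = involutive⇒injective a-involutive

  ρ-injective : Injective _≡_ _≡_ ρ
  ρ-injective = a-injective ∘ involutive⇒injective {f = b} b-involutive

  ρ-unstep : ∀ {y z} → ρ y ≡ z → y ≡ a (b z)
  ρ-unstep {y} refl = sym (trans (cong a (b-involutive (a y))) (a-involutive y))

  ρ^-reflects-a : ∀ k x → (ρ ^ k) (a ((ρ ^ k) x)) ≡ a x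
  ρ^-reflects-a = ^-conjugate λ y → trans (cong b (a-involutive (b (a y)))) (b-involutive (a y))

  ρ^-reflects-b : ∀ k x → (ρ ^ k) (b ((ρ ^ k) x)) ≡ b x
  ρ^-reflects-b = ^-conjugate λ y → cong b (trans (cong a (b-involutive (a y))) (a-involutive y))

  ρ-involutive⇒commute : (∀ x → ρ (ρ x) ≡ x) → ∀ x → b (a x) ≡ a (b x)
  ρ-involutive⇒commute ρ-involutive x = begin
    b (a x)                    ≡⟨ cong (b ∘ a) (sym (b-involutive x)) ⟩
    b (a (b (b x)))            ≡⟨ cong (b ∘ a ∘ b) (sym (a-involutive (b x))) ⟩
    b (a (b (a (a (b x)))))    ≡⟨ ρ-involutive (a (b x)) ⟩
    a (b x)                    ∎

  period3⇒braid : (∀ x → (ρ ^ 3) x ≡ x) → ∀ x → a (b (a x)) ≡ b (a (b x))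
  period3⇒braid period x = begin
    a (b (a x))                                 ≡⟨ sym (period _) ⟩
    b (a (b (a (b (a (a (b (a x))))))))         ≡⟨ cong (b ∘ a ∘ b ∘ a ∘ b) (a-involutive (b (a x))) ⟩
    b (a (b (a (b (b (a x))))))                 ≡⟨ cong (b ∘ a ∘ b ∘ a) (b-involutive (a x)) ⟩
    b (a (b (a (a x))))                         ≡⟨ cong (b ∘ a ∘ b) (a-involutive x) ⟩
    b (a (b x))                                 ∎

  module FixedPointFree (a-fpf : ∀ x → a x ≢ x) (b-fpf : ∀ x → b x ≢ x) where

    ρ^≢a : ∀ m x → (ρ ^ m) x ≢ a x
    ρ^≢a zero          x eq = a-fpf x (sym eq)
    ρ^≢a (suc zero)    x eq = b-fpf (a x) eq
    ρ^≢a (suc (suc m)) x eq = ρ^≢a m (ρ x) (begin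
      (ρ ^ m) (ρ x)   ≡⟨ sym (^-suc ρ m x) ⟩
      (ρ ^ suc m) x   ≡⟨ ρ-unstep eq ⟩
      a (b (a x))     ∎)

    ρ^≢aρ^ : ∀ i j x → (ρ ^ i) x ≢ a ((ρ ^ j) x)
    ρ^≢aρ^ i j x eq = ρ^≢a (j + i) x (begin
      (ρ ^ (j + i)) x            ≡⟨ ^-+ ρ j i x ⟩
      (ρ ^ j) ((ρ ^ i) x)        ≡⟨ cong (ρ ^ j) eq ⟩
      (ρ ^ j) (a ((ρ ^ j) x))    ≡⟨ ρ^-reflects-a j x ⟩
      a x                        ∎)

module AlternatingOrbit {n} (a b : Fin n → Fin n)
  (a-involutive : ∀ x → a (a x) ≡ x) (b-involutive : ∀ x → b (b x) ≡ x)
  (a-fpf : ∀ x → a x ≢ x) (b-fpf : ∀ x → b x ≢ x) where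
  open InvolutionPair a b a-involutive b-involutive
  open FixedPointFree a-fpf b-fpf

  Reachable : Fin n → Fin n → Set
  Reachable = InOrbit (a ∷ b ∷ [])

  ρ^-reachable : ∀ x k → Reachable x ((ρ ^ k) x)
  ρ^-reachable x zero    = ε
  ρ^-reachable x (suc k) = ρ^-reachable x k ◅◅ (step (here refl) ◅ step (there (here refl)) ◅ ε)

  point : ∀ {l m} → Fin n → Fin l ⊎ Fin m → Fin n
  point x (inj₁ k) = (ρ ^ toℕ k) x
  point x (inj₂ k) = a ((ρ ^ toℕ k) x)

  point-reachable : ∀ {l m} x (c : Fin l ⊎ Fin m) → Reachable x (point x c)
  point-reachable x (inj₁ k) = ρ^-reachable x (toℕ k)
  point-reachable x (inj₂ k) = ρ^-reachable x (toℕ k) ◅◅ (step (here refl) ◅ ε)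

  ShortPeriod : Fin n → ℕ → Set
  ShortPeriod x p = ∃ λ d → 0 < d × d ≤ p × (ρ ^ d) x ≡ x

  ρ^-collision⇒shortPeriod : ∀ {x p i j} → i ≢ j → i ≤ p → j ≤ p →
                             (ρ ^ i) x ≡ (ρ ^ j) x → ShortPeriod x p
  ρ^-collision⇒shortPeriod {i = i} {j} i≢j i≤p j≤p eq with ℕₚ.<-cmp i j
  ... | tri< i<j _ _ = j ∸ i , ℕₚ.m<n⇒0<n∸m i<j , ℕₚ.≤-trans (ℕₚ.m∸n≤m j i) j≤p ,
                       ^-collision ρ-injective i<j eq
  ... | tri≈ _ i≡j _ = ⊥-elim (i≢j i≡j)
  ... | tri> _ _ j<i = i ∸ j , ℕₚ.m<n⇒0<n∸m j<i , ℕₚ.≤-trans (ℕₚ.m∸n≤m i j) i≤p ,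
                       ^-collision ρ-injective j<i (sym eq)

  point-collision⇒shortPeriod : ∀ {x p} {c c′ : Fin (suc p) ⊎ Fin p} → c ≢ c′ →
                                point x c ≡ point x c′ → ShortPeriod x p
  point-collision⇒shortPeriod {c = inj₁ i} {inj₁ j} c≢c′ eq =
    ρ^-collision⇒shortPeriod (c≢c′ ∘ cong inj₁ ∘ Finₚ.toℕ-injective)
      (Finₚ.toℕ≤pred[n] i) (Finₚ.toℕ≤pred[n] j) eq
  point-collision⇒shortPeriod {c = inj₂ i} {inj₂ j} c≢c′ eq =
    ρ^-collision⇒shortPeriod (c≢c′ ∘ cong inj₂ ∘ Finₚ.toℕ-injective)
      (ℕₚ.<⇒≤ (Finₚ.toℕ<n i)) (ℕₚ.<⇒≤ (Finₚ.toℕ<n j)) (a-injective eq)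
  point-collision⇒shortPeriod {x = x} {c = inj₁ i} {inj₂ j} _ eq =
    ⊥-elim (ρ^≢aρ^ (toℕ i) (toℕ j) x eq)
  point-collision⇒shortPeriod {x = x} {c = inj₂ i} {inj₁ j} _ eq =
    ⊥-elim (ρ^≢aρ^ (toℕ j) (toℕ i) x (sym eq))

  -- Pigeonhole: the 2p + 1 flags ρᵏ x (k ≤ p) and a (ρᵏ x) (k < p) lie in an orbit of 2p flags.
  shortPeriod : ∀ {x p} {l : List (Fin n)} → length l ≡ 2 * p →
                (∀ {y} → Reachable x y → y ∈ l) → ShortPeriod x p
  shortPeriod {x} {p} {l} l-length into-l = collision (Finₚ.pigeonhole fewer-slots slot)
    where
      slot : Fin (suc p + p) → Fin (length l)
      slot k = index (into-l (point-reachable x (splitAt (suc p) k)))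

      fewer-slots : length l < suc p + p
      fewer-slots rewrite l-length | ℕₚ.+-identityʳ p = ℕₚ.n<1+n (p + p)

      splitAt-injective : ∀ {k k′} → splitAt (suc p) k ≡ splitAt (suc p) k′ → k ≡ k′
      splitAt-injective {k} {k′} eq = begin
        k                                    ≡⟨ sym (Finₚ.join-splitAt (suc p) p k) ⟩
        join (suc p) p (splitAt (suc p) k)   ≡⟨ cong (join (suc p) p) eq ⟩
        join (suc p) p (splitAt (suc p) k′)  ≡⟨ Finₚ.join-splitAt (suc p) p k′ ⟩
        k′                                   ∎
        where open ≡-Reasoning

      same-point : ∀ {k k′} → slot k ≡ slot k′ →
                   point x (splitAt (suc p) k) ≡ point x (splitAt (suc p) k′)
      same-point {k} {k′} same-slot =
        trans (lookup-index (into-l (point-reachable x (splitAt (suc p) k))))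
          (trans (cong (lookup l) same-slot)
            (sym (lookup-index (into-l (point-reachable x (splitAt (suc p) k′))))))

      collision : (∃ λ i → ∃ λ j → i Fin.< j × slot i ≡ slot j) → ShortPeriod x p
      collision (i , j , i<j , same-slot) =
        point-collision⇒shortPeriod {c = splitAt (suc p) i} {splitAt (suc p) j}
          (Finₚ.<⇒≢ i<j ∘ splitAt-injective) (same-point {i} {j} same-slot)

  InBlock : ℕ → Fin n → Fin n → Set
  InBlock d x y = ∃ λ k → k < d × (y ≡ (ρ ^ k) x ⊎ y ≡ a ((ρ ^ k) x))

  block-closed : ∀ {d x} → (ρ ^ suc d) x ≡ x → ∀ {f} → f ∈ a ∷ b ∷ [] →
                 ∀ {y} → InBlock (suc d) x y → InBlock (suc d) x (f y)
  block-closed _ (here refl) (k , k<d , inj₁ refl) = k , k<d , inj₂ refl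
  block-closed _ (here refl) (k , k<d , inj₂ refl) = k , k<d , inj₁ (a-involutive _)
  block-closed {d} {x} period (there (here refl)) (zero , _ , inj₁ refl) =
    d , ℕₚ.n<1+n d , inj₂ (begin
      b x                       ≡⟨ cong b (sym period) ⟩
      b (b (a ((ρ ^ d) x)))     ≡⟨ b-involutive _ ⟩
      a ((ρ ^ d) x)             ∎)
    where open ≡-Reasoning
  block-closed _ (there (here refl)) (suc k , k<d , inj₁ refl) =
    k , ℕₚ.<-trans (ℕₚ.n<1+n k) k<d , inj₂ (b-involutive _)
  block-closed period (there (here refl)) (k , k<d , inj₂ refl) with ℕₚ.m≤n⇒m<n∨m≡n k<d
  ... | inj₁ k+1<d = suc k , k+1<d , inj₁ refl
  ... | inj₂ refl  = zero , z<s , inj₁ period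

  block-code : ∀ {d x y} → InBlock d x y → ∃ λ c → point x (splitAt d {d} c) ≡ y
  block-code {d} {x} (k , k<d , inj₁ refl) = join d d (inj₁ (fromℕ< k<d)) ,
    trans (cong (point x) (Finₚ.splitAt-join d d (inj₁ (fromℕ< k<d))))
          (cong (λ e → (ρ ^ e) x) (Finₚ.toℕ-fromℕ< k<d))
  block-code {d} {x} (k , k<d , inj₂ refl) = join d d (inj₂ (fromℕ< k<d)) ,
    trans (cong (point x) (Finₚ.splitAt-join d d (inj₂ (fromℕ< k<d))))
          (cong (λ e → a ((ρ ^ e) x)) (Finₚ.toℕ-fromℕ< k<d))

  -- Every flag of the orbit is ρᵏ x or a (ρᵏ x) with k below the period, so the period is p.
  orbit-period : ∀ {x p} →
                 (Σ (List (Fin n)) λ l →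
                    Unique l × length l ≡ 2 * p × (∀ y → (y ∈ l) ⇔ Reachable x y)) →
                 (ρ ^ p) x ≡ x
  orbit-period {x} {p} (l , l-unique , l-length , l-orbit) =
    period-is-p (shortPeriod l-length λ {y} → Equivalence.from (l-orbit y))
    where
      period-is-p : ShortPeriod x p → (ρ ^ p) x ≡ x
      period-is-p (zero , () , _)
      period-is-p (suc d , _ , d≤p , period) =
        subst (λ e → (ρ ^ e) x ≡ x) (ℕₚ.≤-antisym d≤p p≤d) period
        where
          l≤ : length l ≤ suc d + suc d
          l≤ = unique⇒length≤ l-unique (point x ∘ splitAt (suc d)) λ {y} y∈l →
                 block-code (orbit-closed (InBlock (suc d) x) (block-closed period)
                   (Equivalence.to (l-orbit y) y∈l) (0 , z<s , inj₁ refl))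

          p≤d : p ≤ suc d
          p≤d = ℕₚ.≮⇒≥ λ d<p → ℕₚ.<⇒≱ (ℕₚ.+-mono-< d<p d<p)
                  (subst (_≤ suc d + suc d) (trans l-length (cong (p +_) (ℕₚ.+-identityʳ p))) l≤)

module SevenFlagOrbitTypeGraph {R₀ R₁ R₂ : Fin 7 → Fin 7}
  (R₀-involutive : ∀ i → R₀ (R₀ i) ≡ i) (R₁-involutive : ∀ i → R₁ (R₁ i) ≡ i)
  (R₂-involutive : ∀ i → R₂ (R₂ i) ≡ i) (R₀R₂-commute : ∀ i → R₀ (R₂ i) ≡ R₂ (R₀ i))
  (face-period : ∀ i → ((R₁ ∘ R₀) ^ 3) i ≡ i) (vertex-period : ∀ i → ((R₂ ∘ R₁) ^ 7) i ≡ i)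
  (connected : ∀ i j → InOrbit (R₁ ∷ R₂ ∷ []) i j) where
  open InvolutionPair R₁ R₂ R₁-involutive R₂-involutive
  open ≡-Reasoning

  braid : ∀ i → R₀ (R₁ (R₀ i)) ≡ R₁ (R₀ (R₁ i))
  braid = InvolutionPair.period3⇒braid R₀ R₁ R₀-involutive R₁-involutive face-period

  ρ-fixedPointFree : ∀ y → ρ y ≢ y
  ρ-fixedPointFree y ρy≡y =
    7≰2 (coveredByTwo⇒≤2 λ j → orbit-closed Pair closed (connected y j) (inj₁ refl))
    where
      Pair : Fin 7 → Set
      Pair j = j ≡ y ⊎ j ≡ R₁ y

      closed : ∀ {f} → f ∈ R₁ ∷ R₂ ∷ [] → ∀ {j} → Pair j → Pair (f j)
      closed (here refl)         (inj₁ refl) = inj₂ refl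
      closed (here refl)         (inj₂ refl) = inj₁ (R₁-involutive y)
      closed (there (here refl)) (inj₁ refl) = inj₂ (begin
        R₂ y              ≡⟨ cong R₂ (sym ρy≡y) ⟩
        R₂ (R₂ (R₁ y))    ≡⟨ R₂-involutive (R₁ y) ⟩
        R₁ y              ∎)
      closed (there (here refl)) (inj₂ refl) = inj₁ ρy≡y

      7≰2 : ¬ 7 ≤ 2
      7≰2 (s≤s (s≤s ()))

  ρ^-aperiodic : ∀ d y → gcd d 7 ≡ 1 → (ρ ^ d) y ≢ y
  ρ^-aperiodic d y coprime period =
    ρ-fixedPointFree y (subst (λ e → (ρ ^ e) y ≡ y) coprime
      (^-gcd-fixed {f = ρ} {d} {7} {y} period (vertex-period y)))

  coprime-to-7 : ∀ {d} → 0 < d → d < 7 → gcd d 7 ≡ 1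
  coprime-to-7 {1} _ _ = refl
  coprime-to-7 {2} _ _ = refl
  coprime-to-7 {3} _ _ = refl
  coprime-to-7 {4} _ _ = refl
  coprime-to-7 {5} _ _ = refl
  coprime-to-7 {6} _ _ = refl
  coprime-to-7 {suc (suc (suc (suc (suc (suc (suc _))))))} _
    (s≤s (s≤s (s≤s (s≤s (s≤s (s≤s (s≤s ())))))))

  double-coprime-to-7 : ∀ (j : Fin 7) → j ≢ zero → gcd (toℕ j + toℕ j) 7 ≡ 1
  double-coprime-to-7 zero j≢0 = ⊥-elim (j≢0 refl)
  double-coprime-to-7 (suc zero) _ = refl
  double-coprime-to-7 (suc (suc zero)) _ = refl
  double-coprime-to-7 (suc (suc (suc zero))) _ = refl
  double-coprime-to-7 (suc (suc (suc (suc zero)))) _ = refl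
  double-coprime-to-7 (suc (suc (suc (suc (suc zero))))) _ = refl
  double-coprime-to-7 (suc (suc (suc (suc (suc (suc zero)))))) _ = refl

  ρ^-distinct : ∀ {i j} z → i < j → j < 7 → (ρ ^ i) z ≢ (ρ ^ j) z
  ρ^-distinct {i} {j} z i<j j<7 eq = ρ^-aperiodic (j ∸ i) z
    (coprime-to-7 (ℕₚ.m<n⇒0<n∸m i<j) (ℕₚ.≤-<-trans (ℕₚ.m∸n≤m j i) j<7))
    (^-collision ρ-injective i<j eq)

  ρ-orbit-injective : ∀ z → Injective _≡_ _≡_ (λ (j : Fin 7) → (ρ ^ toℕ j) z)
  ρ-orbit-injective z {i} {j} eq with ℕₚ.<-cmp (toℕ i) (toℕ j)
  ... | tri< i<j _ _ = ⊥-elim (ρ^-distinct z i<j (Finₚ.toℕ<n j) eq)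
  ... | tri≈ _ i≡j _ = Finₚ.toℕ-injective i≡j
  ... | tri> _ _ j<i = ⊥-elim (ρ^-distinct z j<i (Finₚ.toℕ<n i) (sym eq))

  ρ-orbit-covers : ∀ z y → ∃ λ (j : Fin 7) → (ρ ^ toℕ j) z ≡ y
  ρ-orbit-covers z = injective⇒surjective (ρ-orbit-injective z)

  reflection-fixedPoint-unique : ∀ {r : Fin 7 → Fin 7} → (∀ k y → (ρ ^ k) (r ((ρ ^ k) y)) ≡ r y) →
                                 ∀ {f y} → r f ≡ f → r y ≡ y → y ≡ f
  reflection-fixedPoint-unique {r} r-reflects {f} {y} rf≡f ry≡y with ρ-orbit-covers f y
  ... | zero  , refl = refl
  ... | suc j , refl = ⊥-elim (ρ^-aperiodic (k + k) f (double-coprime-to-7 (suc j) λ ()) (begin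
    (ρ ^ (k + k)) f          ≡⟨ ^-+ ρ k k f ⟩
    (ρ ^ k) ((ρ ^ k) f)      ≡⟨ cong (ρ ^ k) (sym ry≡y) ⟩
    (ρ ^ k) (r ((ρ ^ k) f))  ≡⟨ r-reflects k f ⟩
    r f                      ≡⟨ rf≡f ⟩
    f                        ∎))
    where
      k : ℕ
      k = toℕ (suc j)

  -- If R₂ z = ρᵏ z then R₂ fixes ρ^(4k) z, 4 being the inverse of 2 modulo 7.
  R₂-fixedPoint : ∃ λ f → R₂ f ≡ f
  R₂-fixedPoint = fixedPoint (ρ-orbit-covers zero (R₂ zero))
    where
      fixedPoint : (∃ λ (j : Fin 7) → (ρ ^ toℕ j) zero ≡ R₂ zero) → ∃ λ f → R₂ f ≡ f
      fixedPoint (j , ρᵏ0≡R₂0) = (ρ ^ h) zero , ^-injective ρ-injective h (begin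
          (ρ ^ h) (R₂ ((ρ ^ h) zero))   ≡⟨ ρ^-reflects-b h zero ⟩
          R₂ zero                       ≡⟨ sym ρᵏ0≡R₂0 ⟩
          (ρ ^ k) zero                  ≡⟨ cong (ρ ^ k) (sym (^-*-fixed {f = ρ} (vertex-period zero) k)) ⟩
          (ρ ^ k) ((ρ ^ (k * 7)) zero)  ≡⟨ sym (^-+ ρ k (k * 7) zero) ⟩
          (ρ ^ (k + k * 7)) zero        ≡⟨ cong (λ e → (ρ ^ e) zero) (k+7k≡4k+4k k) ⟩
          (ρ ^ (h + h)) zero            ≡⟨ ^-+ ρ h h zero ⟩
          (ρ ^ h) ((ρ ^ h) zero)        ∎)
        where
          k h : ℕ
          k = toℕ j
          h = 4 * k

          k+7k≡4k+4k : ∀ k → k + k * 7 ≡ 4 * k + 4 * k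
          k+7k≡4k+4k = solve-∀

  module AroundFixedPoint (f : Fin 7) (R₂f≡f : R₂ f ≡ f) where

    e : ℕ → Fin 7
    e j = (ρ ^ j) f

    R₂-e : ∀ i j → i + j ≡ 7 → R₂ (e i) ≡ e j
    R₂-e i j i+j≡7 = ^-injective ρ-injective i (begin
      (ρ ^ i) (R₂ (e i))   ≡⟨ ρ^-reflects-b i f ⟩
      R₂ f                 ≡⟨ R₂f≡f ⟩
      f                    ≡⟨ sym (vertex-period f) ⟩
      e 7                  ≡⟨ cong e (sym i+j≡7) ⟩
      e (i + j)            ≡⟨ ^-+ ρ i j f ⟩
      (ρ ^ i) (e j)        ∎)

    R₁-e : ∀ i j → suc i + j ≡ 7 → R₁ (e i) ≡ e j
    R₁-e i j eq = trans (sym (R₂-involutive (R₁ (e i)))) (R₂-e (suc i) j eq)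

    R₀f≡f : R₀ f ≡ f
    R₀f≡f = reflection-fixedPoint-unique ρ^-reflects-b R₂f≡f (begin
      R₂ (R₀ f)   ≡⟨ sym (R₀R₂-commute f) ⟩
      R₀ (R₂ f)   ≡⟨ cong R₀ R₂f≡f ⟩
      R₀ f        ∎)

    R₀e₆≡e₃ : R₀ (e 6) ≡ e 3
    R₀e₆≡e₃ = reflection-fixedPoint-unique ρ^-reflects-a (R₁-e 3 3 refl) (begin
      R₁ (R₀ (e 6))    ≡⟨ cong (R₁ ∘ R₀) (sym (R₁-e 0 6 refl)) ⟩
      R₁ (R₀ (R₁ f))   ≡⟨ sym (braid f) ⟩
      R₀ (R₁ (R₀ f))   ≡⟨ cong (R₀ ∘ R₁) R₀f≡f ⟩
      R₀ (R₁ f)        ≡⟨ cong R₀ (R₁-e 0 6 refl) ⟩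
      R₀ (e 6)         ∎)

    R₀e₁≡e₄ : R₀ (e 1) ≡ e 4
    R₀e₁≡e₄ = begin
      R₀ (e 1)         ≡⟨ cong R₀ (sym (R₂-e 6 1 refl)) ⟩
      R₀ (R₂ (e 6))    ≡⟨ R₀R₂-commute (e 6) ⟩
      R₂ (R₀ (e 6))    ≡⟨ cong R₂ R₀e₆≡e₃ ⟩
      R₂ (e 3)         ≡⟨ R₂-e 3 4 refl ⟩
      e 4              ∎

    R₁R₂-fixes-R₀e₂ : R₁ (R₂ (R₀ (e 2))) ≡ R₀ (e 2)
    R₁R₂-fixes-R₀e₂ = begin
      R₁ (R₂ (R₀ (e 2)))   ≡⟨ cong R₁ (sym (R₀R₂-commute (e 2))) ⟩
      R₁ (R₀ (R₂ (e 2)))   ≡⟨ cong (R₁ ∘ R₀) (R₂-e 2 5 refl) ⟩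
      R₁ (R₀ (e 5))        ≡⟨ cong (R₁ ∘ R₀) (sym (R₁-e 1 5 refl)) ⟩
      R₁ (R₀ (R₁ (e 1)))   ≡⟨ sym (braid (e 1)) ⟩
      R₀ (R₁ (R₀ (e 1)))   ≡⟨ cong (R₀ ∘ R₁) R₀e₁≡e₄ ⟩
      R₀ (R₁ (e 4))        ≡⟨ cong R₀ (R₁-e 4 2 refl) ⟩
      R₀ (e 2)             ∎

    absurd : ⊥
    absurd = ρ-fixedPointFree (R₀ (e 2)) (begin
      R₂ (R₁ (R₀ (e 2)))              ≡⟨ cong (R₂ ∘ R₁) (sym R₁R₂-fixes-R₀e₂) ⟩
      R₂ (R₁ (R₁ (R₂ (R₀ (e 2)))))    ≡⟨ cong R₂ (R₁-involutive _) ⟩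
      R₂ (R₂ (R₀ (e 2)))              ≡⟨ R₂-involutive _ ⟩
      R₀ (e 2)                        ∎)

  absurd : ⊥
  absurd = AroundFixedPoint.absurd (proj₁ R₂-fixedPoint) (proj₂ R₂-fixedPoint)

module FlagOrbits {n} (M : PreMap n) where
  open PreMap M
  open Automorphism
  open ≡-Reasoning

  Commutes : (Fin n → Fin n) → Set
  Commutes r = ∀ (a : Automorphism M) x → φ a (r x) ≡ r (φ a x)

  commutes-inverse : ∀ {r} (a : Automorphism M) → (∀ x → φ a (r x) ≡ r (φ a x)) →
                     ∀ x → ψ a (r x) ≡ r (ψ a x)
  commutes-inverse {r} a a-commutes x = begin
    ψ a (r x)               ≡⟨ cong (ψ a ∘ r) (sym (φψ a x)) ⟩
    ψ a (r (φ a (ψ a x)))   ≡⟨ cong (ψ a) (sym (a-commutes (ψ a x))) ⟩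
    ψ a (φ a (r (ψ a x)))   ≡⟨ ψφ a (r (ψ a x)) ⟩
    r (ψ a x)               ∎

  inverse : Automorphism M → Automorphism M
  inverse a = record
    { φ = ψ a ; ψ = φ a ; φψ = ψφ a ; ψφ = φψ a
    ; c₀ = commutes-inverse a (c₀ a)
    ; c₁ = commutes-inverse a (c₁ a)
    ; c₂ = commutes-inverse a (c₂ a) }

  _⨾_ : Automorphism M → Automorphism M → Automorphism M
  a ⨾ b = record
    { φ = φ b ∘ φ a ; ψ = ψ a ∘ ψ b
    ; φψ = λ x → trans (cong (φ b) (φψ a (ψ b x))) (φψ b x)
    ; ψφ = λ x → trans (cong (ψ a) (ψφ b (φ a x))) (ψφ a x)
    ; c₀ = λ x → trans (cong (φ b) (c₀ a x)) (c₀ b (φ a x))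
    ; c₁ = λ x → trans (cong (φ b) (c₁ a x)) (c₁ b (φ a x))
    ; c₂ = λ x → trans (cong (φ b) (c₂ a x)) (c₂ b (φ a x)) }

  sameFlagOrbit-sym : ∀ {x y} → SameFlagOrbit M x y → SameFlagOrbit M y x
  sameFlagOrbit-sym {x} (a , refl) = inverse a , ψφ a x

  sameFlagOrbit-trans : ∀ {x y z} → SameFlagOrbit M x y → SameFlagOrbit M y z → SameFlagOrbit M x z
  sameFlagOrbit-trans (a , refl) (b , refl) = a ⨾ b , refl

  module Transversal {k} (rep : Fin k → Fin n)
    (rep-distinct : ∀ i j → SameFlagOrbit M (rep i) (rep j) → i ≡ j)
    (rep-covers : ∀ x → ∃ λ i → SameFlagOrbit M (rep i) x) where

    orbitOf : Fin n → Fin k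
    orbitOf x = proj₁ (rep-covers x)

    orbitOf-resp : ∀ {x y} → SameFlagOrbit M x y → orbitOf x ≡ orbitOf y
    orbitOf-resp {x} {y} same = rep-distinct _ _
      (sameFlagOrbit-trans (proj₂ (rep-covers x))
        (sameFlagOrbit-trans same (sameFlagOrbit-sym (proj₂ (rep-covers y)))))

    orbitOf-rep : ∀ i → orbitOf (rep i) ≡ i
    orbitOf-rep i = rep-distinct _ _ (proj₂ (rep-covers (rep i)))

    induced : (Fin n → Fin n) → Fin k → Fin k
    induced r i = orbitOf (r (rep i))

    Induces : (Fin n → Fin n) → (Fin k → Fin k) → Set
    Induces f F = ∀ x → orbitOf (f x) ≡ F (orbitOf x)

    commutes⇒induces : ∀ {r} → Commutes r → Induces r (induced r)
    commutes⇒induces {r} r-commutes x with a , φa[rep]≡x ← proj₂ (rep-covers x) =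
      sym (orbitOf-resp (a , trans (r-commutes a (rep (orbitOf x))) (cong r φa[rep]≡x)))

    induces-∘ : ∀ {f g F G} → Induces f F → Induces g G → Induces (g ∘ f) (G ∘ F)
    induces-∘ {G = G} f↓ g↓ x = trans (g↓ _) (cong G (f↓ x))

    induces-^ : ∀ {f F} → Induces f F → ∀ m → Induces (f ^ m) (F ^ m)
    induces-^         f↓ zero    x = refl
    induces-^ {F = F} f↓ (suc m) x = trans (f↓ _) (cong F (induces-^ f↓ m x))

    induced-≗ : ∀ {f g F G} → Induces f F → Induces g G → f ≗ g → F ≗ G
    induced-≗ {f} {g} {F} {G} f↓ g↓ f≗g i = begin
      F i                  ≡⟨ cong F (sym (orbitOf-rep i)) ⟩
      F (orbitOf (rep i))  ≡⟨ sym (f↓ (rep i)) ⟩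
      orbitOf (f (rep i))  ≡⟨ cong orbitOf (f≗g (rep i)) ⟩
      orbitOf (g (rep i))  ≡⟨ g↓ (rep i) ⟩
      G (orbitOf (rep i))  ≡⟨ cong G (orbitOf-rep i) ⟩
      G i                  ∎

    induces-path : ∀ {f g F G} → Induces f F → Induces g G → ∀ {x y} →
                   InOrbit (f ∷ g ∷ []) x y → InOrbit (F ∷ G ∷ []) (orbitOf x) (orbitOf y)
    induces-path f↓ g↓ ε = ε
    induces-path f↓ g↓ (step (here refl) ◅ path) =
      subst (Step _ _) (sym (f↓ _)) (step (here refl)) ◅ induces-path f↓ g↓ path
    induces-path f↓ g↓ (step (there (here refl)) ◅ path) =
      subst (Step _ _) (sym (g↓ _)) (step (there (here refl))) ◅ induces-path f↓ g↓ path

    commutes⇒induces-∘ : ∀ {r s} → Commutes r → Commutes s → Induces (s ∘ r) (induced s ∘ induced r)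
    commutes⇒induces-∘ {r} {s} r-commutes s-commutes =
      induces-∘ {F = induced r} {G = induced s}
        (commutes⇒induces r-commutes) (commutes⇒induces s-commutes)

    induced-involutive : ∀ {r} → Commutes r → (∀ x → r (r x) ≡ x) → ∀ i → induced r (induced r i) ≡ i
    induced-involutive r-commutes = induced-≗ (commutes⇒induces-∘ r-commutes r-commutes) (λ _ → refl)

    induced-commute : ∀ {r s} → Commutes r → Commutes s → (∀ x → r (s x) ≡ s (r x)) →
                      ∀ i → induced r (induced s i) ≡ induced s (induced r i)
    induced-commute r-commutes s-commutes =
      induced-≗ (commutes⇒induces-∘ s-commutes r-commutes) (commutes⇒induces-∘ r-commutes s-commutes)

    induced-period : ∀ {r s} → Commutes r → Commutes s → ∀ m → (∀ x → ((s ∘ r) ^ m) x ≡ x) →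
                     ∀ i → ((induced s ∘ induced r) ^ m) i ≡ i
    induced-period r-commutes s-commutes m =
      induced-≗ (induces-^ (commutes⇒induces-∘ r-commutes s-commutes) m) (λ _ → refl)

    vertexTransitive⇒connected : VertexTransitive M →
                                 ∀ i j → InOrbit (induced r₁ ∷ induced r₂ ∷ []) i j
    vertexTransitive⇒connected transitive i j with a , path ← transitive (rep i) (rep j) =
      subst₂ (InOrbit _) (trans (sym (orbitOf-resp (a , refl))) (orbitOf-rep i)) (orbitOf-rep j)
        (induces-path (commutes⇒induces c₁) (commutes⇒induces c₂) path)

mainTheorem5 : (n : ℕ) (M : PreMap n) →
    IsMap M → Equivelar M 3 7 → VertexTransitive M → ¬ FlagOrbitCount M 7
mainTheorem5 n M ((r₀-involutive , r₀-fpf) , (r₁-involutive , r₁-fpf) , (r₂-involutive , r₂-fpf) ,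
                  (r₀r₂-involutive , _) , _)
             (faces , vertices) transitive (rep , rep-distinct , rep-covers) =
  SevenFlagOrbitTypeGraph.absurd
    (induced-involutive c₀ r₀-involutive) (induced-involutive c₁ r₁-involutive)
    (induced-involutive c₂ r₂-involutive)
    (induced-commute c₀ c₂
      (InvolutionPair.ρ-involutive⇒commute r₂ r₀ r₂-involutive r₀-involutive r₀r₂-involutive))
    (induced-period c₀ c₁ 3 λ x →
      AlternatingOrbit.orbit-period r₀ r₁ r₀-involutive r₁-involutive r₀-fpf r₁-fpf {p = 3} (faces x))
    (induced-period c₁ c₂ 7 λ x →
      AlternatingOrbit.orbit-period r₁ r₂ r₁-involutive r₂-involutive r₁-fpf r₂-fpf {p = 7} (vertices x))
    (vertexTransitive⇒connected transitive)
  where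
    open PreMap M
    open Automorphism
    open FlagOrbits M
    open Transversal rep rep-distinct rep-covers
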